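{- The categories $\square^{\mathrm{op}}$, $\mathcal{G}_c$ and $\mathcal{G}_d$ (defined in the context) are isomorphic.
   Context: For $n\in\mathbb{N}$ let $[n]=\{0,\dots,n-1\}$. A function $f:A\to B+C$ is injective on the left part if $f(x)=f(y)=b$ with $b\in B$ implies $x=y$. The category $\square$ has objects $\mathbb{N}$; a morphism $m\to n$ is a function $f:[m]\to[n]+\{0,1\}$ injective on the left part; composite of $f:m\to n$, $g:n\to p$ is $(g+\mathrm{id}_{\{0,1\}})\circ f$. $\square^{\mathrm{op}}$ is its opposite. A graph is $(V,E)$ with $E\subseteq V\times V$; a graph morphism $(V,E)\to(V',E')$ is $f:V\to V'$ with $(s,t)\in E\Rightarrow (f(s),f(t))\in E'$, sending edge $(s,t)$ to $(f(s),f(t))$. The standard cube graph $C_n$ has vertices $\{0,1\}^n$ and edges: a loop at each vertex and an edge $(u,v)$ whenever $u,v$ differ exactly in coordinate $i$ with $u_i=0,v_i=1$. Its reachability preorder is the coordinatewise order, with meets/joins the coordinatewise min/max; a morphism $g:C_m\to C_n$ preserves meets/joins if $g(u\wedge v)=g(u)\wedge g(v)$ / $g(u\vee v)=g(u)\vee g(v)$ for all $u,v$. The dimension of a loop is "trivial"; that of a non-loop edge between vertices differing in coordinate $i$ is $i$. $g$ is dimension-preserving if any two edges of $C_m$ with equal dimension are sent to edges of $C_n$ with equal dimension. $\mathcal{G}_c$: objects $\mathbb{N}$, morphisms $m\to n$ the graph morphisms $C_m\to C_n$ preserving binary meets and joins. $\mathcal{G}_d$: objects $\mathbb{N}$, morphisms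 $m\to n$ the dimension-preserving graph morphisms $C_m\to C_n$. In both, composition is composition of functions. -}

module Defs where

open import Data.Nat using (ℕ)
open import Data.Fin using (Fin)
open import Data.Bool using (Bool; true; false; _∧_; _∨_)
open import Data.Vec using (Vec; lookup; zipWith)
open import Data.Maybe using (Maybe; just; nothing)
open import Data.Sum using (_⊎_; inj₁; inj₂)
open import Data.Product using (Σ; _,_; proj₁; proj₂; _×_)
open import Relation.Binary.PropositionalEquality using (_≡_; _≢_; refl; sym; trans; cong)
open import Relation.Nullary using (yes; no)

-- Minimal notion of (strict) category: objects, hom-sets, an equality of
-- morphisms, identities and composition.  (Only what is needed to state
-- isomorphism of categories.)

record Cat : Set₁ where
  field
    Obj : Set
    Hom : Obj → Obj → Set
    _≈_ : ∀ {a b} → Hom a b → Hom a b → Set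
    id  : ∀ {a} → Hom a a
    _∘_ : ∀ {a b c} → Hom b c → Hom a b → Hom a c

  transport : ∀ {a a' b b'} → a ≡ a' → b ≡ b' → Hom a b → Hom a' b'
  transport refl refl f = f

record Functor (C D : Cat) : Set where
  private
    module C = Cat C
    module D = Cat D
  field
    F₀    : C.Obj → D.Obj
    F₁    : ∀ {a b} → C.Hom a b → D.Hom (F₀ a) (F₀ b)
    F-resp : ∀ {a b} {f g : C.Hom a b} → f C.≈ g → F₁ f D.≈ F₁ g
    F-id  : ∀ {a} → F₁ (C.id {a}) D.≈ D.id
    F-∘   : ∀ {a b c} (g : C.Hom b c) (f : C.Hom a b) →
            F₁ (g C.∘ f) D.≈ (F₁ g D.∘ F₁ f)

record Iso (C D : Cat) : Set where
  private
    module C = Cat C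
    module D = Cat D
  field
    F : Functor C D
    G : Functor D C
  open Functor F renaming (F₀ to F₀; F₁ to F₁)
  open Functor G renaming (F₀ to G₀; F₁ to G₁; F-id to G-id; F-∘ to G-∘)
  field
    GF₀ : ∀ a → G₀ (F₀ a) ≡ a
    GF₁ : ∀ {a b} (f : C.Hom a b) → C.transport (GF₀ a) (GF₀ b) (G₁ (F₁ f)) C.≈ f
    FG₀ : ∀ a → F₀ (G₀ a) ≡ a
    FG₁ : ∀ {a b} (f : D.Hom a b) → D.transport (FG₀ a) (FG₀ b) (F₁ (G₁ f)) D.≈ f

-- The box category □ and its opposite.
-- [n] is Fin n, {0,1} is Bool (0 = false, 1 = true).

InjLeft : ∀ {m n} → (Fin m → Fin n ⊎ Bool) → Set
InjLeft {m} {n} f = ∀ (x y : Fin m) (b : Fin n) → f x ≡ inj₁ b → f y ≡ inj₁ b → x ≡ y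

record □Hom (m n : ℕ) : Set where
  constructor □hom
  field
    fun : Fin m → Fin n ⊎ Bool
    inj : InjLeft fun
open □Hom

plusId : ∀ {n p} → (Fin n → Fin p ⊎ Bool) → Fin n ⊎ Bool → Fin p ⊎ Bool
plusId g (inj₁ j) = g j
plusId g (inj₂ b) = inj₂ b

private
  plusId-left : ∀ {n p} (g : Fin n → Fin p ⊎ Bool) (z : Fin n ⊎ Bool) (c : Fin p) →
                plusId g z ≡ inj₁ c → Σ (Fin n) λ j → z ≡ inj₁ j × g j ≡ inj₁ c
  plusId-left g (inj₁ j) c e = j , refl , e
  plusId-left g (inj₂ b) c ()

□id : ∀ {n} → □Hom n n
□id = □hom inj₁ (λ { x y b refl refl → refl })

□comp : ∀ {m n p} → □Hom n p → □Hom m n → □Hom m p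
□comp g f = □hom (λ x → plusId (fun g) (fun f x)) injc
  where
  injc : InjLeft (λ x → plusId (fun g) (fun f x))
  injc x y c ex ey with plusId-left (fun g) (fun f x) c ex | plusId-left (fun g) (fun f y) c ey
  ... | j , fx , gj | j' , fy , gj' with inj g j j' c gj gj'
  ... | refl = inj f x y j fx fy

□op : Cat
□op = record
  { Obj = ℕ
  ; Hom = λ m n → □Hom n m
  ; _≈_ = λ f g → ∀ x → fun f x ≡ fun g x
  ; id  = □id
  ; _∘_ = λ g f → □comp f g
  }

-- HasDim u v d : (u,v) is an edge of C_n of dimension d, where
-- d = nothing means "trivial" (a loop) and d = just i means a non-loop
-- edge in direction i (u, v differ exactly in coordinate i, u_i = 0, v_i = 1).

HasDim : ∀ {n} → Vec Bool n → Vec Bool n → Maybe (Fin n) → Set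
HasDim u v nothing  = u ≡ v
HasDim u v (just i) = lookup u i ≡ false × lookup v i ≡ true ×
                      (∀ j → j ≢ i → lookup u j ≡ lookup v j)

Edge : ∀ {n} → Vec Bool n → Vec Bool n → Set
Edge {n} u v = Σ (Maybe (Fin n)) (HasDim u v)

IsGraphMor : ∀ {m n} → (Vec Bool m → Vec Bool n) → Set
IsGraphMor g = ∀ u v → Edge u v → Edge (g u) (g v)

PresMeets : ∀ {m n} → (Vec Bool m → Vec Bool n) → Set
PresMeets g = ∀ u v → g (zipWith _∧_ u v) ≡ zipWith _∧_ (g u) (g v)

PresJoins : ∀ {m n} → (Vec Bool m → Vec Bool n) → Set
PresJoins g = ∀ u v → g (zipWith _∨_ u v) ≡ zipWith _∨_ (g u) (g v)

DimPres : ∀ {m n} → (Vec Bool m → Vec Bool n) → Set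
DimPres {m} {n} g = ∀ {u v u' v' : Vec Bool m} {d : Maybe (Fin m)} {e e' : Maybe (Fin n)} →
  HasDim u v d → HasDim u' v' d →
  HasDim (g u) (g v) e → HasDim (g u') (g v') e' → e ≡ e'

record GcHom (m n : ℕ) : Set where
  constructor gchom
  field
    fun   : Vec Bool m → Vec Bool n
    graph : IsGraphMor fun
    meets : PresMeets fun
    joins : PresJoins fun

record GdHom (m n : ℕ) : Set where
  constructor gdhom
  field
    fun   : Vec Bool m → Vec Bool n
    graph : IsGraphMor fun
    dim   : DimPres fun

Gc : Cat
Gc = record
  { Obj = ℕ
  ; Hom = GcHom
  ; _≈_ = λ f g → ∀ u → GcHom.fun f u ≡ GcHom.fun g u
  ; id  = gchom (λ u → u) (λ u v e → e) (λ u v → refl) (λ u v → refl)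
  ; _∘_ = λ g f → gchom (λ u → GcHom.fun g (GcHom.fun f u))
            (λ u v e → GcHom.graph g _ _ (GcHom.graph f u v e))
            (λ u v → trans (cong (GcHom.fun g) (GcHom.meets f u v)) (GcHom.meets g _ _))
            (λ u v → trans (cong (GcHom.fun g) (GcHom.joins f u v)) (GcHom.joins g _ _))
  }

private
  dim-∘ : ∀ {l m n} (g : GdHom m n) (f : GdHom l m) →
          DimPres (λ u → GdHom.fun g (GdHom.fun f u))
  dim-∘ g f {u} {v} {u'} {v'} h h' k k'
    with GdHom.graph f u v (_ , h) | GdHom.graph f u' v' (_ , h')
  ... | d1 , hd1 | d2 , hd2 with GdHom.dim f h h' hd1 hd2
  ... | refl = GdHom.dim g hd1 hd2 k k'

Gd : Cat
Gd = record
  { Obj = ℕ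
  ; Hom = GdHom
  ; _≈_ = λ f g → ∀ u → GdHom.fun f u ≡ GdHom.fun g u
  ; id  = gdhom (λ u → u) (λ u v e → e) (λ h h' k k' → dimId h h' k k')
  ; _∘_ = λ g f → gdhom (λ u → GdHom.fun g (GdHom.fun f u))
            (λ u v e → GdHom.graph g _ _ (GdHom.graph f u v e))
            (dim-∘ g f)
  }
  where
  hasDim-unique : ∀ {n} {u v : Vec Bool n} {d e} → HasDim u v d → HasDim u v e → d ≡ e
  hasDim-unique {d = nothing} {nothing} h k = refl
  hasDim-unique {d = nothing} {just j} refl (a , b , _) with trans (sym a) b
  ... | ()
  hasDim-unique {d = just i} {nothing} (a , b , _) refl with trans (sym a) b
  ... | ()
  hasDim-unique {d = just i} {just j} (a , b , c) (a' , b' , c') with i Data.Fin.≟ j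
  ... | yes p = cong just p
  ... | no ¬p with trans (trans (sym a) (c' i ¬p)) b
  ... | ()
  dimId : ∀ {n} → DimPres {n} {n} (λ u → u)
  dimId h h' k k' = trans (sym (hasDim-unique h k)) (hasDim-unique h' k')

-- A □-morphism f : n → m acts on cubes by f* u = (u_{f j})_j, reading f j ∈ {0,1} as a constant
-- coordinate; f can be read off from f* on 0 and the unit vectors eᵢ, and f* is a graph morphism
-- preserving meets, joins and edge dimensions. Conversely, let g be a morphism of Gc or Gd and
-- say that direction i moves output coordinate j if g(eᵢ)_j ≠ g(0)_j. Along any edge in
-- direction i, output coordinate j then jumps to 1 if i moves j and stays put otherwise
-- (for Gc because g(u ∨ eᵢ) = g u ∨ g eᵢ and g 0 = g u ∧ g eᵢ; for Gd because the edge has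
-- the same image dimension as 0 → eᵢ), and at most one direction moves j. Climbing from 0 to u
-- one coordinate at a time shows g = f* for the □-morphism sending j to the direction moving it,
-- or to the constant g(0)_j. Both categories therefore consist exactly of the maps f*.
module Submission where

open import Defs
open import Data.Nat using (ℕ; zero; suc)
open import Data.Fin using (Fin; zero; suc; _≟_)
open import Data.Fin.Properties using (any?)
open import Data.Bool using (Bool; true; false; _∧_; _∨_; _xor_)
open import Data.Bool.Properties
  using (∧-idem; ∨-idem; ∧-zeroʳ; ∨-zeroʳ; ∨-identityʳ; xor-same; xor-identityʳ; ¬-not)
  renaming (_≟_ to _≟ᵇ_)
open import Data.Vec using (Vec; []; _∷_; lookup; zipWith; tabulate; replicate)
open import Data.Vec.Properties
  using (lookup∘tabulate; lookup-zipWith; lookup-replicate; tabulate∘lookup; tabulate-cong)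
open import Data.Maybe using (Maybe; just; nothing; maybe′)
open import Data.Maybe.Properties using (just-injective)
open import Data.Sum using (_⊎_; inj₁; inj₂)
import Data.Sum.Properties as Sum
open import Data.Product using (∃; _×_; _,_; proj₁; proj₂)
open import Relation.Binary.PropositionalEquality
open import Relation.Nullary using (Dec; yes; no; does; contradiction)
open import Relation.Nullary.Decidable using (dec-true; dec-false)
open import Function using (_∘′_)
open □Hom

vec-ext : ∀ {A : Set} {n} {u v : Vec A n} → (∀ i → lookup u i ≡ lookup v i) → u ≡ v
vec-ext {u = u} {v} u≐v =
  trans (sym (tabulate∘lookup u)) (trans (tabulate-cong u≐v) (tabulate∘lookup v))

zeros : ∀ {m} → Vec Bool m
zeros = replicate _ false

lookup-zeros : ∀ {m} (i : Fin m) → lookup zeros i ≡ false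
lookup-zeros i = lookup-replicate i false

unit : ∀ {m} → Fin m → Vec Bool m
unit i = tabulate (λ k → does (k ≟ i))

lookup-unit-self : ∀ {m} (i : Fin m) → lookup (unit i) i ≡ true
lookup-unit-self i = trans (lookup∘tabulate _ i) (dec-true (i ≟ i) refl)

lookup-unit-other : ∀ {m} {i k : Fin m} → k ≢ i → lookup (unit i) k ≡ false
lookup-unit-other {i = i} {k} k≢i = trans (lookup∘tabulate _ k) (dec-false (k ≟ i) k≢i)

lookup-unit-true : ∀ {m} {i k : Fin m} → lookup (unit i) k ≡ true → k ≡ i
lookup-unit-true {i = i} {k} eq with k ≟ i
... | yes k≡i = k≡i
... | no k≢i = contradiction (trans (sym eq) (lookup-unit-other k≢i)) λ ()

source≢target : ∀ {n} {a b : Vec Bool n} {i} → HasDim a b (just i) → lookup a i ≢ lookup b i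
source≢target (a≡0 , b≡1 , _) eq = contradiction (trans (sym a≡0) (trans eq b≡1)) λ ()

hasDim-differs : ∀ {n} {a b : Vec Bool n} {e} j → HasDim a b e → lookup a j ≢ lookup b j → e ≡ just j
hasDim-differs {e = nothing} j refl a≢b = contradiction refl a≢b
hasDim-differs {e = just k} j (_ , _ , same) a≢b with j ≟ k
... | yes refl = refl
... | no j≢k = contradiction (same j j≢k) a≢b

hasDim-unique : ∀ {n} {a b : Vec Bool n} {d e} → HasDim a b d → HasDim a b e → d ≡ e
hasDim-unique {d = nothing} {nothing} _ _ = refl
hasDim-unique {a = a} {d = nothing} {just j} refl h = contradiction refl (source≢target {a = a} {a} h)
hasDim-unique {a = a} {b} {d = just i} h h' = sym (hasDim-differs i h' (source≢target {a = a} {b} h))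

hasDim-target-unique : ∀ {n} {a b b' : Vec Bool n} {d} → HasDim a b d → HasDim a b' d → b ≡ b'
hasDim-target-unique {d = nothing} refl refl = refl
hasDim-target-unique {b = b} {b'} {d = just i} (_ , b≡1 , same) (_ , b'≡1 , same') = vec-ext on
  where
  on : ∀ k → lookup b k ≡ lookup b' k
  on k with k ≟ i
  ... | yes refl = trans b≡1 (sym b'≡1)
  ... | no k≢i = trans (sym (same k k≢i)) (same' k k≢i)

hasDim-same : ∀ {n} {a b a' b' : Vec Bool n} {e} → HasDim a b e → HasDim a' b' e →
              ∀ j → lookup a j ≡ lookup b j → lookup a' j ≡ lookup b' j
hasDim-same {e = nothing} _ refl j _ = refl
hasDim-same {a = a} {b} {e = just k} h (_ , _ , same') j a≡b with j ≟ k
... | yes refl = contradiction a≡b (source≢target {a = a} {b} h)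
... | no j≢k = same' j j≢k

-- Edges of the same dimension raise the same coordinate from 0 to 1 and fix all others.
hasDim-transfer : ∀ {n} {a b a' b' : Vec Bool n} {e} → HasDim a b e → HasDim a' b' e →
                  ∀ j → lookup b' j ≡ (lookup b j xor lookup a j) ∨ lookup a' j
hasDim-transfer {a = a} {b} {a'} h h' j with lookup a j ≟ᵇ lookup b j
... | yes a≡b = trans (sym (hasDim-same h h' j a≡b))
                      (cong (_∨ lookup a' j) (sym (trans (cong (lookup b j xor_) a≡b) (xor-same (lookup b j)))))
... | no a≢b with hasDim-differs j h a≢b
... | refl rewrite proj₁ h | proj₁ (proj₂ h) | proj₁ (proj₂ h') = refl

unit-hasDim : ∀ {m} (i : Fin m) → HasDim zeros (unit i) (just i)
unit-hasDim i =
  lookup-zeros i , lookup-unit-self i , λ k k≢i → trans (lookup-zeros k) (sym (lookup-unit-other k≢i))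

join-unit-hasDim : ∀ {m} {u : Vec Bool m} {i} → lookup u i ≡ false →
                   HasDim u (zipWith _∨_ u (unit i)) (just i)
join-unit-hasDim {u = u} {i} u≡0 =
  u≡0 ,
  trans (lookup-zipWith _∨_ i u (unit i)) (trans (cong (lookup u i ∨_) (lookup-unit-self i)) (∨-zeroʳ _)) ,
  λ k k≢i → sym (trans (lookup-zipWith _∨_ k u (unit i))
                       (trans (cong (lookup u k ∨_) (lookup-unit-other k≢i)) (∨-identityʳ _)))

unit-join-hasDim : ∀ {m} {i i' : Fin m} → i ≢ i' → HasDim (unit i) (zipWith _∨_ (unit i) (unit i')) (just i')
unit-join-hasDim {i = i} i≢i' = join-unit-hasDim {u = unit i} (lookup-unit-other (i≢i' ∘′ sym))

meet-unit : ∀ {m} {u : Vec Bool m} {i} → lookup u i ≡ false → zipWith _∧_ u (unit i) ≡ zeros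
meet-unit {u = u} {i} u≡0 =
  vec-ext λ k → trans (lookup-zipWith _∧_ k u (unit i)) (trans (on k) (sym (lookup-zeros k)))
  where
  on : ∀ k → lookup u k ∧ lookup (unit i) k ≡ false
  on k with k ≟ i
  ... | yes refl rewrite u≡0 = refl
  ... | no k≢i = trans (cong (lookup u k ∧_) (lookup-unit-other k≢i)) (∧-zeroʳ _)

unit-meet-unit : ∀ {m} {i i' : Fin m} → i ≢ i' → zipWith _∧_ (unit i) (unit i') ≡ zeros
unit-meet-unit {i = i} i≢i' = meet-unit {u = unit i} (lookup-unit-other (i≢i' ∘′ sym))

cube-induction : ∀ {m} (P : Vec Bool m → Set) → P zeros →
                 (∀ {u v i} → HasDim u v (just i) → P u → P v) → ∀ u → P u
cube-induction {zero} P p0 step [] = p0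
cube-induction {suc m} P p0 step (b ∷ u) =
  raise b (cube-induction (λ u → P (false ∷ u)) p0 (step ∘′ cons-hasDim) u)
  where
  cons-hasDim : ∀ {x} {u v : Vec Bool m} {i} → HasDim u v (just i) → HasDim (x ∷ u) (x ∷ v) (just (suc i))
  cons-hasDim (u≡0 , v≡1 , same) =
    u≡0 , v≡1 , λ { zero _ → refl ; (suc k) k≢i → same k (k≢i ∘′ cong suc) }
  raise : ∀ b → P (false ∷ u) → P (b ∷ u)
  raise false p = p
  raise true p = step (refl , refl , λ { zero 0≢0 → contradiction refl 0≢0 ; (suc k) _ → refl }) p

sel : ∀ {m} → Vec Bool m → Fin m ⊎ Bool → Bool
sel u (inj₁ i) = lookup u i
sel u (inj₂ b) = b

act : ∀ {m n} → □Hom n m → Vec Bool m → Vec Bool n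
act f u = tabulate (λ j → sel u (fun f j))

lookup-act : ∀ {m n} (f : □Hom n m) u j → lookup (act f u) j ≡ sel u (fun f j)
lookup-act f u = lookup∘tabulate (λ j → sel u (fun f j))

act-resp : ∀ {m n} (f g : □Hom n m) → (∀ j → fun f j ≡ fun g j) → ∀ u → act f u ≡ act g u
act-resp f g f≐g u = tabulate-cong λ j → cong (sel u) (f≐g j)

act-id : ∀ {m} (u : Vec Bool m) → act □id u ≡ u
act-id = tabulate∘lookup

act-∘ : ∀ {l m n} (f : □Hom m l) (g : □Hom n m) u → act (□comp f g) u ≡ act g (act f u)
act-∘ f g u = tabulate-cong λ k → sel-plusId (fun g k)
  where
  sel-plusId : ∀ x → sel u (plusId (fun f) x) ≡ sel (act f u) x
  sel-plusId (inj₁ j) = sym (lookup-act f u j)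
  sel-plusId (inj₂ b) = refl

act-zipWith : ∀ {m n} (op : Bool → Bool → Bool) → (∀ b → op b b ≡ b) →
              (f : □Hom n m) → ∀ u v → act f (zipWith op u v) ≡ zipWith op (act f u) (act f v)
act-zipWith op op-idem f u v = vec-ext λ j → begin
  lookup (act f (zipWith op u v)) j        ≡⟨ lookup-act f _ j ⟩
  sel (zipWith op u v) (fun f j)           ≡⟨ sel-zipWith (fun f j) ⟩
  op (sel u (fun f j)) (sel v (fun f j))   ≡⟨ sym (cong₂ op (lookup-act f u j) (lookup-act f v j)) ⟩
  op (lookup (act f u) j) (lookup (act f v) j) ≡⟨ sym (lookup-zipWith op j (act f u) (act f v)) ⟩
  lookup (zipWith op (act f u) (act f v)) j ∎
  where
  open ≡-Reasoning
  sel-zipWith : ∀ x → sel (zipWith op u v) x ≡ op (sel u x) (sel v x)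
  sel-zipWith (inj₁ i) = lookup-zipWith op i u v
  sel-zipWith (inj₂ b) = sym (op-idem b)

witness : ∀ {m} {P : Fin m → Set} → Dec (∃ P) → Maybe (Fin m)
witness (yes (i , _)) = just i
witness (no _) = nothing

_≟⊎_ : ∀ {m} (x y : Fin m ⊎ Bool) → Dec (x ≡ y)
_≟⊎_ = Sum.≡-dec _≟_ _≟ᵇ_

imageDim : ∀ {m n} → □Hom n m → Maybe (Fin m) → Maybe (Fin n)
imageDim f nothing = nothing
imageDim f (just i) = witness (any? (λ j → fun f j ≟⊎ inj₁ i))

sel-off-axis : ∀ {m} {u v : Vec Bool m} {i} → HasDim u v (just i) →
               ∀ x → x ≢ inj₁ i → sel u x ≡ sel v x
sel-off-axis (_ , _ , same) (inj₁ k) x≢i = same k (x≢i ∘′ cong inj₁)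
sel-off-axis _ (inj₂ b) _ = refl

act-hasDim : ∀ {m n} (f : □Hom n m) {u v d} → HasDim u v d → HasDim (act f u) (act f v) (imageDim f d)
act-hasDim f {d = nothing} refl = refl
act-hasDim f {u} {v} {just i} h with any? (λ j → fun f j ≟⊎ inj₁ i)
... | yes (j , fj≡i) =
  trans (lookup-act f u j) (trans (cong (sel u) fj≡i) (proj₁ h)) ,
  trans (lookup-act f v j) (trans (cong (sel v) fj≡i) (proj₁ (proj₂ h))) ,
  λ k k≢j → trans (lookup-act f u k)
                  (trans (sel-off-axis h (fun f k) λ fk≡i → k≢j (inj f k j i fk≡i fj≡i))
                         (sym (lookup-act f v k)))
... | no none = tabulate-cong λ j → sel-off-axis h (fun f j) λ fj≡i → none (j , fj≡i)

act-graph : ∀ {m n} (f : □Hom n m) → IsGraphMor (act f)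
act-graph f u v (d , h) = imageDim f d , act-hasDim f h

act-dimPres : ∀ {m n} (f : □Hom n m) → DimPres (act f)
act-dimPres f h h' k k' = trans (hasDim-unique k (act-hasDim f h)) (sym (hasDim-unique k' (act-hasDim f h')))

moves : ∀ {m n} → (Vec Bool m → Vec Bool n) → Fin m → Fin n → Bool
moves g i j = lookup (g (unit i)) j xor lookup (g zeros) j

-- Output coordinate j of a cube map g is either the input coordinate that moves it, or constant.
classify : ∀ {m n} → (Vec Bool m → Vec Bool n) → Fin n → Fin m ⊎ Bool
classify g j = maybe′ inj₁ (inj₂ (lookup (g zeros) j)) (witness (any? (λ i → moves g i j ≟ᵇ true)))

moves-coordinate : ∀ {m n} (g : Vec Bool m → Vec Bool n) {j k} →
                   (∀ u → lookup (g u) j ≡ lookup u k) → ∀ i → moves g i j ≡ lookup (unit i) k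
moves-coordinate g {k = k} g≐k i =
  trans (cong₂ _xor_ (g≐k (unit i)) (trans (g≐k zeros) (lookup-zeros k))) (xor-identityʳ _)

classify-unique : ∀ {m n} (g : Vec Bool m → Vec Bool n) j x →
                  (∀ u → lookup (g u) j ≡ sel u x) → classify g j ≡ x
classify-unique g j (inj₁ k) g≐k with any? (λ i → moves g i j ≟ᵇ true)
... | yes (i , mv) = cong inj₁ (sym (lookup-unit-true (trans (sym (moves-coordinate g g≐k i)) mv)))
... | no none = contradiction (k , trans (moves-coordinate g g≐k k) (lookup-unit-self k)) none
classify-unique g j (inj₂ b) g≐b with any? (λ i → moves g i j ≟ᵇ true)
... | yes (i , mv) =
  contradiction (trans (sym mv) (trans (cong₂ _xor_ (g≐b (unit i)) (g≐b zeros)) (xor-same b))) λ ()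
... | no _ = cong inj₂ (g≐b zeros)

classify-act : ∀ {m n} (f : □Hom n m) j → classify (act f) j ≡ fun f j
classify-act f j = classify-unique (act f) j (fun f j) (λ u → lookup-act f u j)

act-injective : ∀ {m n} {f f' : □Hom n m} → (∀ u → act f u ≡ act f' u) → ∀ j → fun f j ≡ fun f' j
act-injective {f = f} {f'} f≐f' j =
  trans (sym (classify-act f j))
        (classify-unique (act f) j (fun f' j) λ u →
           trans (cong (λ w → lookup w j) (f≐f' u)) (lookup-act f' u j))

MovesAlongEdges : ∀ {m n} → (Vec Bool m → Vec Bool n) → Set
MovesAlongEdges g = ∀ {u v i} j → HasDim u v (just i) → lookup (g v) j ≡ moves g i j ∨ lookup (g u) j

MovedByAtMostOne : ∀ {m n} → (Vec Bool m → Vec Bool n) → Set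
MovedByAtMostOne g = ∀ {i i'} j → moves g i j ≡ true → moves g i' j ≡ true → i ≡ i'

axis-hasDim : ∀ {m n} {g : Vec Bool m → Vec Bool n} → IsGraphMor g →
              ∀ {i j} → moves g i j ≡ true → HasDim (g zeros) (g (unit i)) (just j)
axis-hasDim {g = g} graph {i} {j} mv =
  subst (HasDim (g zeros) (g (unit i))) (hasDim-differs {a = g zeros} {g (unit i)} j h differs) h
  where
  h : HasDim (g zeros) (g (unit i)) _
  h = proj₂ (graph zeros (unit i) (just i , unit-hasDim i))
  differs : lookup (g zeros) j ≢ lookup (g (unit i)) j
  differs eq =
    contradiction (trans (sym mv) (trans (cong (gᵢ xor_) eq) (xor-same gᵢ))) λ ()
    where gᵢ = lookup (g (unit i)) j

module Representation {m n} (g : Vec Bool m → Vec Bool n) (graph : IsGraphMor g)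
                      (along : MovesAlongEdges g) (atMostOne : MovedByAtMostOne g) where

  classify-moves : ∀ {i j} → classify g j ≡ inj₁ i → moves g i j ≡ true
  classify-moves {j = j} cj with any? (λ i → moves g i j ≟ᵇ true)
  classify-moves refl | yes (_ , mv) = mv

  classify-injLeft : InjLeft (classify g)
  classify-injLeft j j' i cj cj' =
    just-injective (hasDim-unique {a = g zeros} {g (unit i)}
                                  (axis-hasDim graph (classify-moves cj)) (axis-hasDim graph (classify-moves cj')))

  classify-represents : ∀ j u → lookup (g u) j ≡ sel u (classify g j)
  classify-represents j = cube-induction (λ u → lookup (g u) j ≡ sel u (classify g j)) bottom step
    where
    bottom : lookup (g zeros) j ≡ sel zeros (classify g j)
    bottom with any? (λ i → moves g i j ≟ᵇ true)
    ... | yes (i , mv) = trans (proj₁ (axis-hasDim graph mv)) (sym (lookup-zeros i))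
    ... | no _ = refl

    sel-step : ∀ {u v i} → HasDim u v (just i) → moves g i j ∨ sel u (classify g j) ≡ sel v (classify g j)
    sel-step {i = i} h with any? (λ i → moves g i j ≟ᵇ true)
    ... | no none rewrite ¬-not (λ mv → none (i , mv)) = refl
    ... | yes (k , mk) with k ≟ i
    ...   | yes refl rewrite mk = sym (proj₁ (proj₂ h))
    ...   | no k≢i rewrite ¬-not (λ mv → k≢i (atMostOne j mk mv)) = proj₂ (proj₂ h) k k≢i

    step : ∀ {u v i} → HasDim u v (just i) →
           lookup (g u) j ≡ sel u (classify g j) → lookup (g v) j ≡ sel v (classify g j)
    step {u} {v} {i} h ih = begin
      lookup (g v) j                      ≡⟨ along j h ⟩
      moves g i j ∨ lookup (g u) j        ≡⟨ cong (moves g i j ∨_) ih ⟩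
      moves g i j ∨ sel u (classify g j)  ≡⟨ sel-step h ⟩
      sel v (classify g j)                ∎
      where open ≡-Reasoning

  represent : □Hom n m
  represent = □hom (classify g) classify-injLeft

  act-represent : ∀ u → act represent u ≡ g u
  act-represent u = vec-ext λ j → trans (lookup-act represent u j) (sym (classify-represents j u))

module _ {m n} (g : GcHom m n) where
  open GcHom g renaming (fun to g′)

  private
    lookup-meet : ∀ u v j → lookup (g′ (zipWith _∧_ u v)) j ≡ lookup (g′ u) j ∧ lookup (g′ v) j
    lookup-meet u v j = trans (cong (λ w → lookup w j) (meets u v)) (lookup-zipWith _∧_ j (g′ u) (g′ v))

    lookup-join : ∀ u v j → lookup (g′ (zipWith _∨_ u v)) j ≡ lookup (g′ u) j ∨ lookup (g′ v) j
    lookup-join u v j = trans (cong (λ w → lookup w j) (joins u v)) (lookup-zipWith _∨_ j (g′ u) (g′ v))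

    -- With g(0) = g(u) ∧ g(eᵢ), this expresses g(u ∨ eᵢ) = g(u) ∨ g(eᵢ) through moves.
    join-via-xor : ∀ a b → a ∨ b ≡ (b xor (a ∧ b)) ∨ a
    join-via-xor true  true  = refl
    join-via-xor true  false = refl
    join-via-xor false true  = refl
    join-via-xor false false = refl

  Gc-movesAlongEdges : MovesAlongEdges g′
  Gc-movesAlongEdges {u} {v} {i} j h = begin
    lookup (g′ v) j                              ≡⟨ cong (λ w → lookup (g′ w) j) v≡u∨eᵢ ⟩
    lookup (g′ (zipWith _∨_ u (unit i))) j       ≡⟨ lookup-join u (unit i) j ⟩
    lookup (g′ u) j ∨ lookup (g′ (unit i)) j     ≡⟨ join-via-xor (lookup (g′ u) j) (lookup (g′ (unit i)) j) ⟩
    (lookup (g′ (unit i)) j xor (lookup (g′ u) j ∧ lookup (g′ (unit i)) j)) ∨ lookup (g′ u) j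
      ≡⟨ cong (λ b → (lookup (g′ (unit i)) j xor b) ∨ lookup (g′ u) j) (sym g0≡gu∧geᵢ) ⟩
    moves g′ i j ∨ lookup (g′ u) j               ∎
    where
    open ≡-Reasoning
    v≡u∨eᵢ : v ≡ zipWith _∨_ u (unit i)
    v≡u∨eᵢ = hasDim-target-unique {a = u} h (join-unit-hasDim {u = u} (proj₁ h))
    g0≡gu∧geᵢ : lookup (g′ zeros) j ≡ lookup (g′ u) j ∧ lookup (g′ (unit i)) j
    g0≡gu∧geᵢ = trans (cong (λ w → lookup (g′ w) j) (sym (meet-unit (proj₁ h)))) (lookup-meet u (unit i) j)

  Gc-movedByAtMostOne : MovedByAtMostOne g′
  Gc-movedByAtMostOne {i} {i'} j mv mv' with i ≟ i'
  ... | yes i≡i' = i≡i'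
  ... | no i≢i' = contradiction (begin
      false                                        ≡⟨ sym (proj₁ (axis-hasDim graph mv)) ⟩
      lookup (g′ zeros) j                          ≡⟨ cong (λ w → lookup (g′ w) j) (sym (unit-meet-unit i≢i')) ⟩
      lookup (g′ (zipWith _∧_ (unit i) (unit i'))) j ≡⟨ lookup-meet (unit i) (unit i') j ⟩
      lookup (g′ (unit i)) j ∧ lookup (g′ (unit i')) j
        ≡⟨ cong₂ _∧_ (proj₁ (proj₂ (axis-hasDim graph mv))) (proj₁ (proj₂ (axis-hasDim graph mv'))) ⟩
      true                                         ∎) λ ()
    where open ≡-Reasoning

  Gc→□ : □Hom n m
  Gc→□ = Representation.represent g′ graph Gc-movesAlongEdges Gc-movedByAtMostOne

  act-Gc→□ : ∀ u → act Gc→□ u ≡ g′ u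
  act-Gc→□ = Representation.act-represent g′ graph Gc-movesAlongEdges Gc-movedByAtMostOne

□→Gc : ∀ {m n} → □Hom n m → GcHom m n
□→Gc f = gchom (act f) (act-graph f) (act-zipWith _∧_ ∧-idem f) (act-zipWith _∨_ ∨-idem f)

module _ {m n} (g : GdHom m n) where
  open GdHom g renaming (fun to g′)

  Gd-movesAlongEdges : MovesAlongEdges g′
  Gd-movesAlongEdges {u} {v} {i} j h with graph zeros (unit i) (just i , unit-hasDim i) | graph u v (just i , h)
  ... | _ , hₑ | _ , h' with dim (unit-hasDim i) h hₑ h'
  ... | refl = hasDim-transfer {a = g′ zeros} {g′ (unit i)} hₑ h' j

  Gd-movedByAtMostOne : MovedByAtMostOne g′
  Gd-movedByAtMostOne {i} {i'} j mv mv' with i ≟ i'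
  ... | yes i≡i' = i≡i'
  ... | no i≢i' with graph (unit i) (zipWith _∨_ (unit i) (unit i')) (just i' , unit-join-hasDim i≢i')
  ... | _ , h with dim (unit-hasDim i') (unit-join-hasDim i≢i') (axis-hasDim graph mv') h
  ... | refl = contradiction (trans (sym (proj₁ (proj₂ (axis-hasDim graph mv)))) (proj₁ h)) λ ()

  Gd→□ : □Hom n m
  Gd→□ = Representation.represent g′ graph Gd-movesAlongEdges Gd-movedByAtMostOne

  act-Gd→□ : ∀ u → act Gd→□ u ≡ g′ u
  act-Gd→□ = Representation.act-represent g′ graph Gd-movesAlongEdges Gd-movedByAtMostOne

□→Gd : ∀ {m n} → □Hom n m → GdHom m n
□→Gd f = gdhom (act f) (act-graph f) (act-dimPres f)

-- Gc and Gd are definitionally cubeMaps GcHom GcHom.fun … and cubeMaps GdHom GdHom.fun ….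
cubeMaps : (Hom : ℕ → ℕ → Set) → (∀ {m n} → Hom m n → Vec Bool m → Vec Bool n) →
           (∀ {n} → Hom n n) → (∀ {l m n} → Hom m n → Hom l m → Hom l n) → Cat
cubeMaps Hom apply idC compC = record
  { Obj = ℕ
  ; Hom = Hom
  ; _≈_ = λ f g → ∀ u → apply f u ≡ apply g u
  ; id  = idC
  ; _∘_ = compC
  }

module CubeMapIso
  {Hom : ℕ → ℕ → Set} (apply : ∀ {m n} → Hom m n → Vec Bool m → Vec Bool n)
  (idC : ∀ {n} → Hom n n) (compC : ∀ {l m n} → Hom m n → Hom l m → Hom l n)
  (apply-id : ∀ {n} (u : Vec Bool n) → apply idC u ≡ u)
  (apply-∘ : ∀ {l m n} (g : Hom m n) (f : Hom l m) u → apply (compC g f) u ≡ apply g (apply f u))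
  (fromBox : ∀ {m n} → □Hom n m → Hom m n)
  (apply-fromBox : ∀ {m n} (f : □Hom n m) u → apply (fromBox f) u ≡ act f u)
  (toBox : ∀ {m n} → Hom m n → □Hom n m)
  (act-toBox : ∀ {m n} (g : Hom m n) u → act (toBox g) u ≡ apply g u)
  where

  box→cube : Functor □op (cubeMaps Hom apply idC compC)
  box→cube = record
    { F₀ = λ n → n
    ; F₁ = fromBox
    ; F-resp = λ {_} {_} {f} {g} f≐g u →
        trans (apply-fromBox f u) (trans (act-resp f g f≐g u) (sym (apply-fromBox g u)))
    ; F-id = λ u → trans (apply-fromBox □id u) (trans (act-id u) (sym (apply-id u)))
    ; F-∘ = F-∘
    }
    where
    F-∘ : ∀ {a b c} (g : □Hom c b) (f : □Hom b a) u →
          apply (fromBox (□comp f g)) u ≡ apply (compC (fromBox g) (fromBox f)) u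
    F-∘ g f u = begin
      apply (fromBox (□comp f g)) u            ≡⟨ apply-fromBox (□comp f g) u ⟩
      act (□comp f g) u                        ≡⟨ act-∘ f g u ⟩
      act g (act f u)                          ≡⟨ sym (apply-fromBox g (act f u)) ⟩
      apply (fromBox g) (act f u)              ≡⟨ cong (apply (fromBox g)) (sym (apply-fromBox f u)) ⟩
      apply (fromBox g) (apply (fromBox f) u)  ≡⟨ sym (apply-∘ (fromBox g) (fromBox f) u) ⟩
      apply (compC (fromBox g) (fromBox f)) u  ∎
      where open ≡-Reasoning

  cube→box : Functor (cubeMaps Hom apply idC compC) □op
  cube→box = record
    { F₀ = λ n → n
    ; F₁ = toBox
    ; F-resp = λ {_} {_} {f} {g} f≐g → act-injective {f = toBox f} {toBox g} λ u →
        trans (act-toBox f u) (trans (f≐g u) (sym (act-toBox g u)))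
    ; F-id = act-injective {f = toBox idC} {□id} λ u →
        trans (act-toBox idC u) (trans (apply-id u) (sym (act-id u)))
    ; F-∘ = λ g f → act-injective {f = toBox (compC g f)} {□comp (toBox f) (toBox g)} (F-∘ g f)
    }
    where
    F-∘ : ∀ {a b c} (g : Hom b c) (f : Hom a b) u →
          act (toBox (compC g f)) u ≡ act (□comp (toBox f) (toBox g)) u
    F-∘ g f u = begin
      act (toBox (compC g f)) u            ≡⟨ act-toBox (compC g f) u ⟩
      apply (compC g f) u                  ≡⟨ apply-∘ g f u ⟩
      apply g (apply f u)                  ≡⟨ sym (act-toBox g (apply f u)) ⟩
      act (toBox g) (apply f u)            ≡⟨ cong (act (toBox g)) (sym (act-toBox f u)) ⟩
      act (toBox g) (act (toBox f) u)      ≡⟨ sym (act-∘ (toBox f) (toBox g) u) ⟩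
      act (□comp (toBox f) (toBox g)) u    ∎
      where open ≡-Reasoning

  iso : Iso □op (cubeMaps Hom apply idC compC)
  iso = record
    { F   = box→cube
    ; G   = cube→box
    ; GF₀ = λ _ → refl
    ; GF₁ = λ f → act-injective {f = toBox (fromBox f)} {f} λ u →
        trans (act-toBox (fromBox f) u) (apply-fromBox f u)
    ; FG₀ = λ _ → refl
    ; FG₁ = λ g u → trans (apply-fromBox (toBox g) u) (act-toBox g u)
    }

corollary2p16 : Iso □op Gc × Iso □op Gd
corollary2p16 =
  CubeMapIso.iso GcHom.fun (Cat.id Gc) (Cat._∘_ Gc) (λ _ → refl) (λ _ _ _ → refl)
                 □→Gc (λ _ _ → refl) Gc→□ act-Gc→□ ,
  CubeMapIso.iso GdHom.fun (Cat.id Gd) (Cat._∘_ Gd) (λ _ → refl) (λ _ _ _ → refl)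
                 □→Gd (λ _ _ → refl) Gd→□ act-Gd→□
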